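{- Let $U=(E,\mathcal{D},\rho)$ be a U-matroid. If $A\in\mathcal{D}$ and $\rho(A)=|A|=\rho(E)$, then $A$ is a basis of $U$.
   Context: $E$ is a finite set. A U-matroid is a triple $(E,\mathcal{D},\rho)$ where $\mathcal{D}\subseteq2^E$ contains $\emptyset,E$, is closed under union and intersection, and is accessible (every nonempty $A\in\mathcal{D}$ contains some $x$ with $A\setminus\{x\}\in\mathcal{D}$), and $\rho:\mathcal{D}\to\mathbb{N}$ satisfies $\rho(\emptyset)=0$, monotonicity, submodularity, and unit increase ($\rho(A\cup\{e\})-\rho(A)\le 1$ whenever $A,A\cup\{e\}\in\mathcal{D}$). Its base polyhedron is $\{\mathbf{x}\in\mathbb{R}^E:\sum_{a\in A}x_a\le\rho(A)\ \forall A\in\mathcal{D},\ \sum_{e\in E}x_e=\rho(E)\}$; a basis of $U$ is the support of a vertex of the base polyhedron.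
   Formalization: The base polyhedron is taken over ℚ^E in place of $\mathbb{R}^E$, so its vertices, whose supports are the bases, have rational coordinates. -}

module Defs where

open import Data.Nat as ℕ using (ℕ; suc)
open import Data.Bool using (Bool; true; false; not)
open import Data.Fin using (Fin)
import Data.Integer
open import Data.Fin.Subset
open import Data.Vec using (Vec; []; _∷_; tabulate)
open import Data.Product using (Σ; ∃; _×_)
open import Data.Rational as ℚ using (ℚ; 0ℚ; ½)
open import Relation.Binary.PropositionalEquality using (_≡_)
open import Relation.Nullary using (¬_)
open import Relation.Nullary.Decidable using (⌊_⌋)

-- Ground set E = Fin n; subsets of E are Subset n (= Vec Bool n).
-- ρ is given as a total function on subsets, but all axioms (and the
-- base polyhedron) only refer to its values on members of 𝒟.
record UMatroid (n : ℕ) : Set₁ where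
  field
    𝒟 : Subset n → Set
    ρ : Subset n → ℕ
    ∅∈𝒟 : 𝒟 ⊥
    E∈𝒟 : 𝒟 ⊤
    ∪-closed : ∀ {A B} → 𝒟 A → 𝒟 B → 𝒟 (A ∪ B)
    ∩-closed : ∀ {A B} → 𝒟 A → 𝒟 B → 𝒟 (A ∩ B)
    accessible : ∀ {A} → 𝒟 A → Nonempty A → ∃ λ x → x ∈ A × 𝒟 (A - x)
    ρ-∅ : ρ ⊥ ≡ 0
    ρ-mono : ∀ {A B} → 𝒟 A → 𝒟 B → A ⊆ B → ρ A ℕ.≤ ρ B
    ρ-submod : ∀ {A B} → 𝒟 A → 𝒟 B → ρ (A ∪ B) ℕ.+ ρ (A ∩ B) ℕ.≤ ρ A ℕ.+ ρ B
    ρ-unit : ∀ {A} {e : Fin n} → 𝒟 A → 𝒟 (A ∪ ⁅ e ⁆) → ρ (A ∪ ⁅ e ⁆) ℕ.≤ suc (ρ A)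

sumOver : ∀ {n} → Subset n → (Fin n → ℚ) → ℚ
sumOver [] x = 0ℚ
sumOver (true ∷ A) x = x Data.Fin.zero ℚ.+ sumOver A (λ i → x (Data.Fin.suc i))
sumOver (false ∷ A) x = sumOver A (λ i → x (Data.Fin.suc i))

module _ {n : ℕ} (U : UMatroid n) where
  open UMatroid U

  InBasePolyhedron : (Fin n → ℚ) → Set
  InBasePolyhedron x =
    (∀ A → 𝒟 A → sumOver A x ℚ.≤ (Data.Integer.+ ρ A) ℚ./ 1) × (sumOver ⊤ x ≡ (Data.Integer.+ ρ ⊤) ℚ./ 1)

  IsVertex : (Fin n → ℚ) → Set
  IsVertex x = InBasePolyhedron x ×
    (∀ y z → InBasePolyhedron y → InBasePolyhedron z →
      (∀ i → x i ≡ ½ ℚ.* (y i ℚ.+ z i)) → ∀ i → y i ≡ z i)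

  support : (Fin n → ℚ) → Subset n
  support x = tabulate (λ i → not ⌊ x i ℚ.≟ 0ℚ ⌋)

  IsBasis : Subset n → Set
  IsBasis B = ∃ λ x → IsVertex x × support x ≡ B

{-# OPTIONS --safe #-}
module Submission where

-- The witness is the indicator vector of A. Accessibility builds every set of 𝒟 from ∅ one
-- element at a time, so unit increase gives ρ (B ∪ C) + ∣ B ∩ C ∣ ≤ ρ C + ∣ B ∣; with
-- ρ A = ∣ A ∣ this is ∣ D ∩ A ∣ ≤ ρ D, i.e. the indicator lies in the base polyhedron.
-- For P ∈ 𝒟 the sets P ∩ A and P ∪ A are tight, and two points whose midpoint is the
-- indicator have equal sums on every tight set. Every e is added to some P ∈ 𝒟 along an
-- accessible chain of E, and the tight sets for P and P ∪ ⁅ e ⁆ differ exactly by e.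

open import Defs
open import Data.Nat using (ℕ)
open import Data.Fin.Subset using (Subset; ⊤; ∣_∣)
open import Relation.Binary.PropositionalEquality using (_≡_)
open import Data.Product using (_×_)

open import Data.Bool using (Bool; true; false; not)
open import Data.Empty using (⊥-elim)
open import Data.Fin using (Fin; zero; suc; _≟_)
open import Data.Fin.Subset
  using (⊥; ⁅_⁆; _∪_; _∩_; _-_; _∈_; _∉_; _⊆_)
open import Data.Fin.Subset.Properties
import Data.Integer as ℤ
import Data.Integer.Properties as ℤ
open import Data.Nat as ℕ using (suc; _≤_; _<_; _+_)
import Data.Nat.Properties as ℕ
import Data.Nat.Coprimality as Coprimality
open import Data.Nat.Induction using (<-wellFounded)
open import Data.Product using (∃; _,_)
open import Data.Rational as ℚ using (ℚ; 0ℚ; 1ℚ; ½; mkℚ; _/_)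
import Data.Rational.Properties as ℚ
import Data.Rational.Unnormalised as ℚᵘ
import Data.Rational.Unnormalised.Properties as ℚᵘ
open import Data.Sum using (inj₁; inj₂; [_,_]′)
open import Data.Vec using (_∷_; []; lookup; here; there)
open import Data.Vec.Properties using (tabulate-cong; tabulate∘lookup)
open import Function using (id; _∘_; case_of_)
open import Induction.WellFounded using (module All)
import Relation.Binary.Construct.On as On
open import Relation.Binary.PropositionalEquality
  using (refl; sym; trans; cong; cong₂; subst; subst₂; module ≡-Reasoning)
open import Relation.Nullary using (yes; no)
open import Relation.Nullary.Decidable using (⌊_⌋)
open import Algebra.Properties.Group ℚ.+-0-group using (∙-cancelʳ)
open import Algebra.Bundles using (CommutativeMonoid)
open import Algebra.Properties.CommutativeSemigroup
  (CommutativeMonoid.commutativeSemigroup ℚ.+-0-commutativeMonoid)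
  using () renaming (interchange to +-interchange; x∙yz≈y∙xz to +-left-comm)

fromℕ : ℕ → ℚ
fromℕ k = ℤ.+ k / 1

private
  integral : ℕ → ℚ
  integral k = mkℚ (ℤ.+ k) 0 (Coprimality.sym (Coprimality.1-coprimeTo k))

  fromℕ-as-mkℚ : ∀ k → fromℕ k ≡ integral k
  fromℕ-as-mkℚ k = ℚ.normalize-coprime (Coprimality.sym (Coprimality.1-coprimeTo k))

fromℕ-suc : ∀ k → fromℕ (suc k) ≡ 1ℚ ℚ.+ fromℕ k
fromℕ-suc k rewrite fromℕ-as-mkℚ (suc k) | fromℕ-as-mkℚ k =
  ℚ.toℚᵘ-injective (ℚᵘ.≃-trans (ℚᵘ.*≡* cross-product) (ℚᵘ.≃-sym (ℚ.toℚᵘ-homo-+ 1ℚ (integral k))))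
  where
  cross-product : ℤ.+ suc k ℤ.* ℤ.+ 1 ≡ (ℤ.+ 1 ℤ.* ℤ.+ 1 ℤ.+ ℤ.+ k ℤ.* ℤ.+ 1) ℤ.* ℤ.+ 1
  cross-product rewrite ℤ.*-identityʳ (ℤ.+ suc k) | ℤ.*-identityʳ (ℤ.+ k)
                      | ℤ.*-identityʳ (ℤ.+ 1 ℤ.+ ℤ.+ k) = refl

fromℕ-mono-≤ : ∀ {m n} → m ≤ n → fromℕ m ℚ.≤ fromℕ n
fromℕ-mono-≤ {m} {n} m≤n rewrite fromℕ-as-mkℚ m | fromℕ-as-mkℚ n =
  ℚ.*≤* (ℤ.*-monoʳ-≤-nonNeg (ℤ.+ 1) (ℤ.+≤+ m≤n))

½-*-double : ∀ r → ½ ℚ.* (r ℚ.+ r) ≡ r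
½-*-double r = begin
  ½ ℚ.* (r ℚ.+ r)         ≡⟨ ℚ.*-distribˡ-+ ½ r r ⟩
  ½ ℚ.* r ℚ.+ ½ ℚ.* r     ≡⟨ ℚ.*-distribʳ-+ r ½ ½ ⟨
  (½ ℚ.+ ½) ℚ.* r         ≡⟨ ℚ.*-identityˡ r ⟩
  r                       ∎
  where open ≡-Reasoning

midpoint-of-≤⇒≡ : ∀ {y z r} → y ℚ.≤ r → z ℚ.≤ r → ½ ℚ.* (y ℚ.+ z) ≡ r → y ≡ r
midpoint-of-≤⇒≡ {y} {z} {r} y≤r z≤r mid = ℚ.≤-antisym y≤r (ℚ.≮⇒≥ λ y<r →
  ℚ.<-irrefl refl (subst₂ ℚ._<_ mid (½-*-double r)
    (ℚ.*-monoʳ-<-pos ½ (ℚ.+-mono-<-≤ y<r z≤r))))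

sumOver-cong : ∀ {n} (S : Subset n) {x y : Fin n → ℚ} →
               (∀ i → x i ≡ y i) → sumOver S x ≡ sumOver S y
sumOver-cong []          x≗y = refl
sumOver-cong (true ∷ S)  x≗y = cong₂ ℚ._+_ (x≗y zero) (sumOver-cong S (x≗y ∘ suc))
sumOver-cong (false ∷ S) x≗y = sumOver-cong S (x≗y ∘ suc)

sumOver-+ : ∀ {n} (S : Subset n) (x y : Fin n → ℚ) →
            sumOver S (λ i → x i ℚ.+ y i) ≡ sumOver S x ℚ.+ sumOver S y
sumOver-+ []          x y = sym (ℚ.+-identityˡ 0ℚ)
sumOver-+ (true ∷ S)  x y =
  trans (cong (x zero ℚ.+ y zero ℚ.+_) (sumOver-+ S (x ∘ suc) (y ∘ suc)))
        (+-interchange (x zero) (y zero) (sumOver S (x ∘ suc)) (sumOver S (y ∘ suc)))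
sumOver-+ (false ∷ S) x y = sumOver-+ S (x ∘ suc) (y ∘ suc)

sumOver-* : ∀ {n} (S : Subset n) (c : ℚ) (x : Fin n → ℚ) →
            sumOver S (λ i → c ℚ.* x i) ≡ c ℚ.* sumOver S x
sumOver-* []          c x = sym (ℚ.*-zeroʳ c)
sumOver-* (true ∷ S)  c x = trans (cong (c ℚ.* x zero ℚ.+_) (sumOver-* S c (x ∘ suc)))
                                  (sym (ℚ.*-distribˡ-+ c (x zero) (sumOver S (x ∘ suc))))
sumOver-* (false ∷ S) c x = sumOver-* S c (x ∘ suc)

sumOver-midpoint : ∀ {n} (S : Subset n) {x y z : Fin n → ℚ} →
                   (∀ i → x i ≡ ½ ℚ.* (y i ℚ.+ z i)) →
                   sumOver S x ≡ ½ ℚ.* (sumOver S y ℚ.+ sumOver S z)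
sumOver-midpoint S {x} {y} {z} mid = begin
  sumOver S x                                     ≡⟨ sumOver-cong S mid ⟩
  sumOver S (λ i → ½ ℚ.* (y i ℚ.+ z i))           ≡⟨ sumOver-* S ½ (λ i → y i ℚ.+ z i) ⟩
  ½ ℚ.* sumOver S (λ i → y i ℚ.+ z i)             ≡⟨ cong (½ ℚ.*_) (sumOver-+ S y z) ⟩
  ½ ℚ.* (sumOver S y ℚ.+ sumOver S z)             ∎
  where open ≡-Reasoning

sumOver-∪⁅⁆ : ∀ {n} (P : Subset n) (y : Fin n → ℚ) {e} → e ∉ P →
              sumOver (P ∪ ⁅ e ⁆) y ≡ y e ℚ.+ sumOver P y
sumOver-∪⁅⁆ (true ∷ P)  y {zero}  e∉P = ⊥-elim (e∉P here)
sumOver-∪⁅⁆ (false ∷ P) y {zero}  e∉P = cong (λ Q → y zero ℚ.+ sumOver Q (y ∘ suc)) (∪-identityʳ P)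
sumOver-∪⁅⁆ (true ∷ P)  y {suc e} e∉P =
  trans (cong (y zero ℚ.+_) (sumOver-∪⁅⁆ P (y ∘ suc) (e∉P ∘ there)))
        (+-left-comm (y zero) (y (suc e)) (sumOver P (y ∘ suc)))
sumOver-∪⁅⁆ (false ∷ P) y {suc e} e∉P = sumOver-∪⁅⁆ P (y ∘ suc) (e∉P ∘ there)

≡-at-added-point : ∀ {n} {P : Subset n} {e} (y z : Fin n → ℚ) → e ∉ P →
                   sumOver P y ≡ sumOver P z →
                   sumOver (P ∪ ⁅ e ⁆) y ≡ sumOver (P ∪ ⁅ e ⁆) z → y e ≡ z e
≡-at-added-point {P = P} {e} y z e∉P P-agree P+e-agree = ∙-cancelʳ (sumOver P y) (y e) (z e) (begin
  y e ℚ.+ sumOver P y         ≡⟨ sumOver-∪⁅⁆ P y e∉P ⟨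
  sumOver (P ∪ ⁅ e ⁆) y       ≡⟨ P+e-agree ⟩
  sumOver (P ∪ ⁅ e ⁆) z       ≡⟨ sumOver-∪⁅⁆ P z e∉P ⟩
  z e ℚ.+ sumOver P z         ≡⟨ cong (z e ℚ.+_) P-agree ⟨
  z e ℚ.+ sumOver P y         ∎)
  where open ≡-Reasoning

𝟙 : Bool → ℚ
𝟙 true  = 1ℚ
𝟙 false = 0ℚ

indicator : ∀ {n} → Subset n → Fin n → ℚ
indicator A = 𝟙 ∘ lookup A

sumOver-indicator : ∀ {n} (S A : Subset n) → sumOver S (indicator A) ≡ fromℕ ∣ S ∩ A ∣
sumOver-indicator []          []          = refl
sumOver-indicator (true ∷ S)  (true ∷ A)  =
  trans (cong (1ℚ ℚ.+_) (sumOver-indicator S A)) (sym (fromℕ-suc ∣ S ∩ A ∣))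
sumOver-indicator (true ∷ S)  (false ∷ A) = trans (ℚ.+-identityˡ _) (sumOver-indicator S A)
sumOver-indicator (false ∷ S) (a ∷ A)     = sumOver-indicator S A

𝟙-≢0 : ∀ b → not ⌊ 𝟙 b ℚ.≟ 0ℚ ⌋ ≡ b
𝟙-≢0 true  = refl
𝟙-≢0 false = refl

p⊆q⇒p∪q≡q : ∀ {n} {p q : Subset n} → p ⊆ q → p ∪ q ≡ q
p⊆q⇒p∪q≡q {p = p} {q} p⊆q = ⊆-antisym (λ x∈p∪q → [ p⊆q , id ]′ (x∈p∪q⁻ p q x∈p∪q)) (q⊆p∪q p q)

p⊆q⇒p∩q≡p : ∀ {n} {p q : Subset n} → p ⊆ q → p ∩ q ≡ p
p⊆q⇒p∩q≡p {p = p} {q} p⊆q = ⊆-antisym (p∩q⊆p p q) (λ x∈p → x∈p∩q⁺ (x∈p , p⊆q x∈p))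

x∈p⇒⁅x⁆⊆p : ∀ {n} {x : Fin n} {p : Subset n} → x ∈ p → ⁅ x ⁆ ⊆ p
x∈p⇒⁅x⁆⊆p {x = x} x∈p y∈⁅x⁆ = subst (_∈ _) (sym (x∈⁅y⁆⇒x≡y x y∈⁅x⁆)) x∈p

x∉p⇒⁅x⁆∩p≡⊥ : ∀ {n} {x : Fin n} {p : Subset n} → x ∉ p → ⁅ x ⁆ ∩ p ≡ ⊥
x∉p⇒⁅x⁆∩p≡⊥ {x = x} {p} x∉p = Empty-unique λ (y , y∈⁅x⁆∩p) →
  let y∈⁅x⁆ , y∈p = x∈p∩q⁻ ⁅ x ⁆ p y∈⁅x⁆∩p
  in x∉p (subst (_∈ p) (x∈⁅y⁆⇒x≡y x y∈⁅x⁆) y∈p)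

p∪q∪r≡p∪r∪q : ∀ {n} (p q r : Subset n) → (p ∪ q) ∪ r ≡ (p ∪ r) ∪ q
p∪q∪r≡p∪r∪q p q r = begin
  (p ∪ q) ∪ r  ≡⟨ ∪-assoc p q r ⟩
  p ∪ (q ∪ r)  ≡⟨ cong (p ∪_) (∪-comm q r) ⟩
  p ∪ (r ∪ q)  ≡⟨ ∪-assoc p r q ⟨
  (p ∪ r) ∪ q  ∎
  where open ≡-Reasoning

x∈q⇒p∪⁅x⁆∪q≡p∪q : ∀ {n} {x : Fin n} (p : Subset n) {q : Subset n} → x ∈ q →
                   (p ∪ ⁅ x ⁆) ∪ q ≡ p ∪ q
x∈q⇒p∪⁅x⁆∪q≡p∪q {x = x} p {q} x∈q =
  trans (∪-assoc p ⁅ x ⁆ q) (cong (p ∪_) (p⊆q⇒p∪q≡q (x∈p⇒⁅x⁆⊆p x∈q)))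

x∈q⇒p∪⁅x⁆∩q≡p∩q∪⁅x⁆ : ∀ {n} {x : Fin n} (p : Subset n) {q : Subset n} → x ∈ q →
                      (p ∪ ⁅ x ⁆) ∩ q ≡ (p ∩ q) ∪ ⁅ x ⁆
x∈q⇒p∪⁅x⁆∩q≡p∩q∪⁅x⁆ {x = x} p {q} x∈q =
  trans (∩-distribʳ-∪ q p ⁅ x ⁆) (cong ((p ∩ q) ∪_) (p⊆q⇒p∩q≡p (x∈p⇒⁅x⁆⊆p x∈q)))

x∉q⇒p∪⁅x⁆∩q≡p∩q : ∀ {n} {x : Fin n} (p : Subset n) {q : Subset n} → x ∉ q →
                  (p ∪ ⁅ x ⁆) ∩ q ≡ p ∩ q
x∉q⇒p∪⁅x⁆∩q≡p∩q {x = x} p {q} x∉q =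
  trans (∩-distribʳ-∪ q p ⁅ x ⁆)
        (trans (cong ((p ∩ q) ∪_) (x∉p⇒⁅x⁆∩p≡⊥ x∉q)) (∪-identityʳ (p ∩ q)))

∣p∪⁅x⁆∣≡1+∣p∣ : ∀ {n} {p : Subset n} {x} → x ∉ p → ∣ p ∪ ⁅ x ⁆ ∣ ≡ suc ∣ p ∣
∣p∪⁅x⁆∣≡1+∣p∣ {p = true ∷ p}  {zero}  x∉p = ⊥-elim (x∉p here)
∣p∪⁅x⁆∣≡1+∣p∣ {p = false ∷ p} {zero}  x∉p = cong (suc ∘ ∣_∣) (∪-identityʳ p)
∣p∪⁅x⁆∣≡1+∣p∣ {p = true ∷ p}  {suc x} x∉p = cong suc (∣p∪⁅x⁆∣≡1+∣p∣ (x∉p ∘ there))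
∣p∪⁅x⁆∣≡1+∣p∣ {p = false ∷ p} {suc x} x∉p = ∣p∪⁅x⁆∣≡1+∣p∣ (x∉p ∘ there)

x∉p-x : ∀ {n} (p : Subset n) x → x ∉ p - x
x∉p-x (b ∷ p) zero    ()
x∉p-x (b ∷ p) (suc x) (there x∈p-x) = x∉p-x p x x∈p-x

x∈p⇒p-x∪⁅x⁆≡p : ∀ {n} {p : Subset n} {x} → x ∈ p → (p - x) ∪ ⁅ x ⁆ ≡ p
x∈p⇒p-x∪⁅x⁆≡p {p = p} {x} x∈p = ⊆-antisym
  (λ {y} y∈ → [ p─q⊆p p ⁅ x ⁆ , x∈p⇒⁅x⁆⊆p x∈p ]′ (x∈p∪q⁻ (p - x) ⁅ x ⁆ y∈))
  (λ {y} y∈p → x∈p∪q⁺ (case y ≟ x of λ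
     { (yes refl) → inj₂ (x∈⁅x⁆ x)
     ; (no y≢x)   → inj₁ (x∈p∧x≢y⇒x∈p-y y∈p y≢x) }))

module _ {n : ℕ} (U : UMatroid n) where
  open UMatroid U

  Addable : Subset n → Fin n → Set
  Addable B x = 𝒟 B × x ∉ B × 𝒟 (B ∪ ⁅ x ⁆)

  𝒟-induction : (P : Subset n → Set) → P ⊥ →
                (∀ {B x} → Addable B x → P B → P (B ∪ ⁅ x ⁆)) →
                ∀ {B} → 𝒟 B → P B
  𝒟-induction P P⊥ P-step {B} =
    All.wfRec (On.wellFounded ∣_∣ <-wellFounded) _ (λ B → 𝒟 B → P B) go B
    where
    go : ∀ B → (∀ {C} → ∣ C ∣ < ∣ B ∣ → 𝒟 C → P C) → 𝒟 B → P B
    go B rec B∈𝒟 with nonempty? B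
    ... | no B-empty = subst P (sym (Empty-unique B-empty)) P⊥
    ... | yes B-nonempty with accessible B∈𝒟 B-nonempty
    ... | x , x∈B , B-x∈𝒟 = subst P (x∈p⇒p-x∪⁅x⁆≡p x∈B)
            (P-step (B-x∈𝒟 , x∉p-x B x , subst 𝒟 (sym (x∈p⇒p-x∪⁅x⁆≡p x∈B)) B∈𝒟)
                    (rec (x∈p⇒∣p-x∣<∣p∣ x∈B) B-x∈𝒟))

  ∈⇒∃-Addable : ∀ {D e} → 𝒟 D → e ∈ D → ∃ λ B → Addable B e
  ∈⇒∃-Addable {e = e} = 𝒟-induction (λ D → e ∈ D → ∃ λ B → Addable B e) (⊥-elim ∘ ∉⊥) step
    where
    step : ∀ {B x} → Addable B x → (e ∈ B → ∃ λ C → Addable C e) →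
           e ∈ B ∪ ⁅ x ⁆ → ∃ λ C → Addable C e
    step {B} {x} B+x ih e∈B+x with x∈p∪q⁻ B ⁅ x ⁆ e∈B+x
    ... | inj₁ e∈B   = ih e∈B
    ... | inj₂ e∈⁅x⁆ with x∈⁅y⁆⇒x≡y x e∈⁅x⁆
    ...   | refl = B , B+x

  ρ∪+∣∩∣-step : ∀ {B C x} → Addable B x → 𝒟 C →
                ρ ((B ∪ ⁅ x ⁆) ∪ C) + ∣ (B ∪ ⁅ x ⁆) ∩ C ∣ ≤ suc (ρ (B ∪ C) + ∣ B ∩ C ∣)
  ρ∪+∣∩∣-step {B} {C} {x} (B∈𝒟 , x∉B , B+x∈𝒟) C∈𝒟 with x ∈? C
  ... | yes x∈C = ℕ.≤-reflexive (begin-equality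
    ρ ((B ∪ ⁅ x ⁆) ∪ C) + ∣ (B ∪ ⁅ x ⁆) ∩ C ∣
      ≡⟨ cong₂ _+_ (cong ρ (x∈q⇒p∪⁅x⁆∪q≡p∪q B x∈C)) (cong ∣_∣ (x∈q⇒p∪⁅x⁆∩q≡p∩q∪⁅x⁆ B x∈C)) ⟩
    ρ (B ∪ C) + ∣ (B ∩ C) ∪ ⁅ x ⁆ ∣
      ≡⟨ cong (ρ (B ∪ C) +_) (∣p∪⁅x⁆∣≡1+∣p∣ (x∉B ∘ p∩q⊆p B C)) ⟩
    ρ (B ∪ C) + suc ∣ B ∩ C ∣
      ≡⟨ ℕ.+-suc (ρ (B ∪ C)) ∣ B ∩ C ∣ ⟩
    suc (ρ (B ∪ C) + ∣ B ∩ C ∣) ∎)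
    where open ℕ.≤-Reasoning
  ... | no x∉C = begin
    ρ ((B ∪ ⁅ x ⁆) ∪ C) + ∣ (B ∪ ⁅ x ⁆) ∩ C ∣
      ≡⟨ cong₂ _+_ (cong ρ B+x∪C≡B∪C+x) (cong ∣_∣ (x∉q⇒p∪⁅x⁆∩q≡p∩q B x∉C)) ⟩
    ρ ((B ∪ C) ∪ ⁅ x ⁆) + ∣ B ∩ C ∣
      ≤⟨ ℕ.+-monoˡ-≤ ∣ B ∩ C ∣
           (ρ-unit (∪-closed B∈𝒟 C∈𝒟) (subst 𝒟 B+x∪C≡B∪C+x (∪-closed B+x∈𝒟 C∈𝒟))) ⟩
    suc (ρ (B ∪ C) + ∣ B ∩ C ∣) ∎
    where
    open ℕ.≤-Reasoning
    B+x∪C≡B∪C+x : (B ∪ ⁅ x ⁆) ∪ C ≡ (B ∪ C) ∪ ⁅ x ⁆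
    B+x∪C≡B∪C+x = p∪q∪r≡p∪r∪q B ⁅ x ⁆ C

  ρ∪+∣∩∣≤ρ+∣∣ : ∀ {B C} → 𝒟 B → 𝒟 C → ρ (B ∪ C) + ∣ B ∩ C ∣ ≤ ρ C + ∣ B ∣
  ρ∪+∣∩∣≤ρ+∣∣ {C = C} B∈𝒟 C∈𝒟 =
    𝒟-induction (λ B → ρ (B ∪ C) + ∣ B ∩ C ∣ ≤ ρ C + ∣ B ∣) base step B∈𝒟
    where
    base : ρ (⊥ ∪ C) + ∣ ⊥ ∩ C ∣ ≤ ρ C + ∣ ⊥ {n} ∣
    base rewrite ∪-identityˡ C | ∩-zeroˡ C = ℕ.≤-refl

    step : ∀ {B x} → Addable B x → ρ (B ∪ C) + ∣ B ∩ C ∣ ≤ ρ C + ∣ B ∣ →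
           ρ ((B ∪ ⁅ x ⁆) ∪ C) + ∣ (B ∪ ⁅ x ⁆) ∩ C ∣ ≤ ρ C + ∣ B ∪ ⁅ x ⁆ ∣
    step {B} {x} B+x@(_ , x∉B , _) ih = begin
      ρ ((B ∪ ⁅ x ⁆) ∪ C) + ∣ (B ∪ ⁅ x ⁆) ∩ C ∣ ≤⟨ ρ∪+∣∩∣-step B+x C∈𝒟 ⟩
      suc (ρ (B ∪ C) + ∣ B ∩ C ∣)               ≤⟨ ℕ.s≤s ih ⟩
      suc (ρ C + ∣ B ∣)                         ≡⟨ ℕ.+-suc (ρ C) ∣ B ∣ ⟨
      ρ C + suc ∣ B ∣                           ≡⟨ cong (ρ C +_) (∣p∪⁅x⁆∣≡1+∣p∣ x∉B) ⟨
      ρ C + ∣ B ∪ ⁅ x ⁆ ∣                       ∎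
      where open ℕ.≤-Reasoning

  ρ≤∣∣ : ∀ {B} → 𝒟 B → ρ B ≤ ∣ B ∣
  ρ≤∣∣ {B} B∈𝒟 with ρ∪+∣∩∣≤ρ+∣∣ B∈𝒟 ∅∈𝒟
  ... | bound rewrite ∪-identityʳ B | ∩-zeroʳ B | ∣⊥∣≡0 n | ρ-∅ | ℕ.+-identityʳ (ρ B) = bound

  ∣D∩A∣≤ρD : ∀ {A D} → 𝒟 A → ρ A ≡ ∣ A ∣ → 𝒟 D → ∣ D ∩ A ∣ ≤ ρ D
  ∣D∩A∣≤ρD {A} {D} A∈𝒟 ρA≡∣A∣ D∈𝒟 = ℕ.+-cancelˡ-≤ ∣ A ∣ _ _ (begin
    ∣ A ∣ + ∣ D ∩ A ∣      ≡⟨ cong₂ _+_ ρA≡∣A∣ (cong ∣_∣ (∩-comm A D)) ⟨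
    ρ A + ∣ A ∩ D ∣        ≤⟨ ℕ.+-monoˡ-≤ ∣ A ∩ D ∣ (ρ-mono A∈𝒟 (∪-closed A∈𝒟 D∈𝒟) (p⊆p∪q D)) ⟩
    ρ (A ∪ D) + ∣ A ∩ D ∣  ≤⟨ ρ∪+∣∩∣≤ρ+∣∣ A∈𝒟 D∈𝒟 ⟩
    ρ D + ∣ A ∣            ≡⟨ ℕ.+-comm (ρ D) ∣ A ∣ ⟩
    ∣ A ∣ + ρ D            ∎)
    where open ℕ.≤-Reasoning

  ⊆-independent : ∀ {A S} → 𝒟 A → ρ A ≡ ∣ A ∣ → 𝒟 S → S ⊆ A → ρ S ≡ ∣ S ∣
  ⊆-independent {A} {S} A∈𝒟 ρA≡∣A∣ S∈𝒟 S⊆A = ℕ.≤-antisym (ρ≤∣∣ S∈𝒟)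
    (subst (_≤ ρ S) (cong ∣_∣ (p⊆q⇒p∩q≡p S⊆A)) (∣D∩A∣≤ρD A∈𝒟 ρA≡∣A∣ S∈𝒟))

  ⊇-spanning : ∀ {A S} → 𝒟 A → ρ A ≡ ρ ⊤ → 𝒟 S → A ⊆ S → ρ S ≡ ρ A
  ⊇-spanning A∈𝒟 ρA≡ρE S∈𝒟 A⊆S = ℕ.≤-antisym
    (ℕ.≤-trans (ρ-mono S∈𝒟 E∈𝒟 ⊆⊤) (ℕ.≤-reflexive (sym ρA≡ρE))) (ρ-mono A∈𝒟 S∈𝒟 A⊆S)

  midpoint-tight⇒agree : ∀ {x y z S} → InBasePolyhedron U y → InBasePolyhedron U z →
                         (∀ i → x i ≡ ½ ℚ.* (y i ℚ.+ z i)) →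
                         𝒟 S → sumOver S x ≡ fromℕ (ρ S) → sumOver S y ≡ sumOver S z
  midpoint-tight⇒agree {y = y} {z} {S} (y≤ρ , _) (z≤ρ , _) mid S∈𝒟 S-tight =
    trans (midpoint-of-≤⇒≡ (y≤ρ S S∈𝒟) (z≤ρ S S∈𝒟) ½[y+z]≡ρS)
          (sym (midpoint-of-≤⇒≡ (z≤ρ S S∈𝒟) (y≤ρ S S∈𝒟)
                 (trans (cong (½ ℚ.*_) (ℚ.+-comm (sumOver S z) (sumOver S y))) ½[y+z]≡ρS)))
    where
    ½[y+z]≡ρS : ½ ℚ.* (sumOver S y ℚ.+ sumOver S z) ≡ fromℕ (ρ S)
    ½[y+z]≡ρS = trans (sym (sumOver-midpoint S mid)) S-tight

  support-indicator : ∀ A → support U (indicator A) ≡ A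
  support-indicator A = trans (tabulate-cong (𝟙-≢0 ∘ lookup A)) (tabulate∘lookup A)

  module _ {A} (A∈𝒟 : 𝒟 A) (ρA≡∣A∣ : ρ A ≡ ∣ A ∣) (∣A∣≡ρE : ∣ A ∣ ≡ ρ ⊤) where

    indicator-∈-basePolyhedron : InBasePolyhedron U (indicator A)
    indicator-∈-basePolyhedron =
      (λ D D∈𝒟 → subst (ℚ._≤ fromℕ (ρ D)) (sym (sumOver-indicator D A))
                        (fromℕ-mono-≤ (∣D∩A∣≤ρD A∈𝒟 ρA≡∣A∣ D∈𝒟))) ,
      trans (sumOver-indicator ⊤ A) (cong fromℕ (trans (cong ∣_∣ (∩-identityˡ A)) ∣A∣≡ρE))

    module _ {y z} (y∈ : InBasePolyhedron U y) (z∈ : InBasePolyhedron U z)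
             (mid : ∀ i → indicator A i ≡ ½ ℚ.* (y i ℚ.+ z i)) where

      private
        AgreeOn : Subset n → Set
        AgreeOn S = sumOver S y ≡ sumOver S z

        agree : ∀ {S} → 𝒟 S → ∣ S ∩ A ∣ ≡ ρ S → AgreeOn S
        agree {S} S∈𝒟 tight = midpoint-tight⇒agree y∈ z∈ mid S∈𝒟
          (trans (sumOver-indicator S A) (cong fromℕ tight))

        agree-∩ : ∀ {P} → 𝒟 P → AgreeOn (P ∩ A)
        agree-∩ {P} P∈𝒟 = agree P∩A∈𝒟
          (trans (cong ∣_∣ (p⊆q⇒p∩q≡p (p∩q⊆q P A)))
                 (sym (⊆-independent A∈𝒟 ρA≡∣A∣ P∩A∈𝒟 (p∩q⊆q P A))))
          where P∩A∈𝒟 = ∩-closed P∈𝒟 A∈𝒟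

        agree-∪ : ∀ {P} → 𝒟 P → AgreeOn (P ∪ A)
        agree-∪ {P} P∈𝒟 = agree P∪A∈𝒟
          (trans (cong ∣_∣ (trans (∩-comm (P ∪ A) A) (p⊆q⇒p∩q≡p (q⊆p∪q P A))))
                 (trans (sym ρA≡∣A∣)
                        (sym (⊇-spanning A∈𝒟 (trans ρA≡∣A∣ ∣A∣≡ρE) P∪A∈𝒟 (q⊆p∪q P A)))))
          where P∪A∈𝒟 = ∪-closed P∈𝒟 A∈𝒟

      midpoint-indicator⇒≡ : ∀ e → y e ≡ z e
      midpoint-indicator⇒≡ e with ∈⇒∃-Addable E∈𝒟 ∈⊤
      ... | B , B∈𝒟 , e∉B , B+e∈𝒟 with e ∈? A
      ...   | yes e∈A = ≡-at-added-point y z (e∉B ∘ p∩q⊆p B A) (agree-∩ B∈𝒟)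
                          (subst AgreeOn (x∈q⇒p∪⁅x⁆∩q≡p∩q∪⁅x⁆ B e∈A) (agree-∩ B+e∈𝒟))
      ...   | no e∉A  = ≡-at-added-point y z (λ e∈B∪A → [ e∉B , e∉A ]′ (x∈p∪q⁻ B A e∈B∪A))
                          (agree-∪ B∈𝒟) (subst AgreeOn (p∪q∪r≡p∪r∪q B ⁅ e ⁆ A) (agree-∪ B+e∈𝒟))

    indicator-isVertex : IsVertex U (indicator A)
    indicator-isVertex =
      indicator-∈-basePolyhedron , λ y z y∈ z∈ mid → midpoint-indicator⇒≡ y∈ z∈ mid

corollary3p7 : {n : ℕ} (U : UMatroid n) (A : Subset n) →
    UMatroid.𝒟 U A → UMatroid.ρ U A ≡ ∣ A ∣ → ∣ A ∣ ≡ UMatroid.ρ U ⊤ →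
    IsBasis U A
corollary3p7 U A A∈𝒟 ρA≡∣A∣ ∣A∣≡ρE =
  indicator A , indicator-isVertex U A∈𝒟 ρA≡∣A∣ ∣A∣≡ρE , support-indicator U A
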